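{- Let $a,b$ be positive integers with $d=\gcd(a,b)>1$, let $n=pd+q$ with $0\le q<d$. Consider the $a$-$b$ chip-firing game started with $n$ chips at vertex $0$ and the $\frac{a}{d}$-$\frac{b}{d}$ chip-firing game started with $p$ chips at vertex $0$. A finite sequence of vertices is a legal firing sequence in one game if and only if it is legal in the other. Moreover, if in the $\frac{a}{d}$-$\frac{b}{d}$ game such a sequence produces the state with $s_i$ chips at vertex $i$, then in the $a$-$b$ game the same sequence produces the state with $s_0'=ds_0+q$ chips at vertex $0$ and $s_i'=ds_i$ chips at every vertex $i\neq 0$.
   Context: For positive integers $x,y$, the $x$-$y$ chip-firing game on $\mathbb{Z}$: a vertex $i$ holding at least $x+y$ chips may fire, losing $x+y$ chips while vertex $i-1$ gains $x$ and vertex $i+1$ gains $y$. A firing sequence is legal if each vertex, at the moment it fires, has at least $x+y$ chips. -}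

module Defs where

open import Data.Nat using (ℕ; _+_; _∸_; _≤_)
open import Data.Integer as ℤ using (ℤ)
open import Data.List using (List; []; _∷_)
open import Data.Product using (_×_)
open import Data.Unit using (⊤)
open import Relation.Nullary using (yes; no)
open import Relation.Binary.PropositionalEquality using (_≡_)

Config : Set
Config = ℤ → ℕ

initial : ℕ → Config
initial n i with i ℤ.≟ ℤ.0ℤ
... | yes _ = n
... | no  _ = 0

-- x-y firing of vertex i: i loses x+y, i-1 gains x, i+1 gains y.
-- (Only applied when legal, i.e. c i ≥ x + y, so ∸ is exact.)
fire : ℕ → ℕ → ℤ → Config → Config
fire x y i c j with j ℤ.≟ i | j ℤ.≟ (i ℤ.- ℤ.1ℤ) | j ℤ.≟ (i ℤ.+ ℤ.1ℤ)
... | yes _ | _     | _     = c j ∸ (x + y)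
... | no  _ | yes _ | _     = c j + x
... | no  _ | no  _ | yes _ = c j + y
... | no  _ | no  _ | no  _ = c j

Legal : ℕ → ℕ → Config → List ℤ → Set
Legal x y c []      = ⊤
Legal x y c (i ∷ σ) = (x + y ≤ c i) × Legal x y (fire x y i c) σ

run : ℕ → ℕ → Config → List ℤ → Config
run x y c []      = c
run x y c (i ∷ σ) = run x y (fire x y i c) σ

module Submission where

open import Defs
open import Data.Nat using (ℕ; _+_; _*_; _<_; _≤_; _∸_; suc; s≤s; z≤n)
open import Data.Nat.Properties
open import Data.Nat.Tactic.RingSolver using (solve-∀)
open import Data.Nat.GCD using (gcd)
open import Data.Integer as ℤ using (ℤ)
open import Data.List using (List; []; _∷_)
open import Data.Product using (_×_; _,_)
open import Data.Unit using (tt)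
open import Data.Empty using (⊥-elim)
open import Relation.Nullary using (yes; no)
open import Relation.Binary.PropositionalEquality

-- The coarse game moves chips in multiples of d, so the residues r j never change,
-- while the quotient configuration c' follows the fine game.  Since r j < d,
-- a vertex can fire in one game exactly when it can fire in the other.

Scaled : ℕ → Config → Config → Config → Set
Scaled d r c c' = ∀ j → c j ≡ d * c' j + r j

*-≤-+-remainder⁻ : ∀ {s d x r} → r < d → s * d ≤ d * x + r → s ≤ x
*-≤-+-remainder⁻ {s} {d} {x} {r} r<d sd≤ = m<1+n⇒m≤n (*-cancelˡ-< d s (suc x) (begin-strict
    d * s     ≡⟨ *-comm d s ⟩
    s * d     ≤⟨ sd≤ ⟩
    d * x + r <⟨ +-monoʳ-< (d * x) r<d ⟩
    d * x + d ≡⟨ +-comm (d * x) d ⟩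
    d + d * x ≡⟨ *-suc d x ⟨
    d * suc x ∎))
  where open ≤-Reasoning

*-≤-+-remainder : ∀ {s d x} r → s ≤ x → s * d ≤ d * x + r
*-≤-+-remainder {s} {d} {x} r s≤x = begin
  s * d     ≡⟨ *-comm s d ⟩
  d * s     ≤⟨ *-monoʳ-≤ d s≤x ⟩
  d * x     ≤⟨ m≤m+n (d * x) r ⟩
  d * x + r ∎
  where open ≤-Reasoning

scaled-∸ : ∀ {m} d n r → m ≤ n → (d * n + r) ∸ m * d ≡ d * (n ∸ m) + r
scaled-∸ {m} d n r m≤n = begin
  (d * n + r) ∸ m * d   ≡⟨ cong (d * n + r ∸_) (*-comm m d) ⟩
  (d * n + r) ∸ d * m   ≡⟨ +-∸-comm r (*-monoʳ-≤ d m≤n) ⟩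
  d * n ∸ d * m + r     ≡⟨ cong (_+ r) (*-distribˡ-∸ d n m) ⟨
  d * (n ∸ m) + r       ∎
  where open ≡-Reasoning

scaled-+ : ∀ d n r m → d * n + r + m * d ≡ d * (n + m) + r
scaled-+ = solve-∀

fire-scaled : ∀ {d r c c'} x y i → x + y ≤ c' i → Scaled d r c c' →
              Scaled d r (fire (x * d) (y * d) i c) (fire x y i c')
fire-scaled {d} {r} {c} {c'} x y i firable S j
  with j ℤ.≟ i | j ℤ.≟ (i ℤ.- ℤ.1ℤ) | j ℤ.≟ (i ℤ.+ ℤ.1ℤ)
... | yes refl | _     | _     = begin
  c j ∸ (x * d + y * d)          ≡⟨ cong₂ _∸_ (S j) (sym (*-distribʳ-+ d x y)) ⟩
  (d * c' j + r j) ∸ (x + y) * d ≡⟨ scaled-∸ d (c' j) (r j) firable ⟩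
  d * (c' j ∸ (x + y)) + r j     ∎
  where open ≡-Reasoning
... | no _     | yes _ | _     = trans (cong (_+ x * d) (S j)) (scaled-+ d (c' j) (r j) x)
... | no _     | no _  | yes _ = trans (cong (_+ y * d) (S j)) (scaled-+ d (c' j) (r j) y)
... | no _     | no _  | no _  = S j

firable-scaled : ∀ {d r c c'} x y i → Scaled d r c c' → x + y ≤ c' i → x * d + y * d ≤ c i
firable-scaled {d} {r} x y i S firable =
  subst₂ _≤_ (*-distribʳ-+ d x y) (sym (S i)) (*-≤-+-remainder (r i) firable)

firable-unscaled : ∀ {d r c c'} x y i → (∀ j → r j < d) → Scaled d r c c' →
                   x * d + y * d ≤ c i → x + y ≤ c' i
firable-unscaled {d} {r} x y i r<d S firable =
  *-≤-+-remainder⁻ (r<d i) (subst₂ _≤_ (sym (*-distribʳ-+ d x y)) (S i) firable)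

legal-scaled : ∀ {d r c c'} x y (σ : List ℤ) → Scaled d r c c' →
               Legal x y c' σ → Legal (x * d) (y * d) c σ
legal-scaled x y []      S _              = tt
legal-scaled x y (i ∷ σ) S (firable , L) =
  firable-scaled x y i S firable , legal-scaled x y σ (fire-scaled x y i firable S) L

legal-unscaled : ∀ {d r c c'} x y (σ : List ℤ) → (∀ j → r j < d) → Scaled d r c c' →
                 Legal (x * d) (y * d) c σ → Legal x y c' σ
legal-unscaled x y []      r<d S _              = tt
legal-unscaled x y (i ∷ σ) r<d S (firable , L) =
  firable′ , legal-unscaled x y σ r<d (fire-scaled x y i firable′ S) L
  where firable′ = firable-unscaled x y i r<d S firable

run-scaled : ∀ {d r c c'} x y (σ : List ℤ) → Scaled d r c c' →
             Legal x y c' σ → Scaled d r (run (x * d) (y * d) c σ) (run x y c' σ)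
run-scaled x y []      S _              = S
run-scaled x y (i ∷ σ) S (firable , L) = run-scaled x y σ (fire-scaled x y i firable S) L

initial-scaled : ∀ d p q → Scaled d (initial q) (initial (p * d + q)) (initial p)
initial-scaled d p q j with j ℤ.≟ ℤ.0ℤ
... | yes _ = cong (_+ q) (*-comm p d)
... | no  _ = sym (cong (_+ 0) (*-zeroʳ d))

initial-< : ∀ {d q} → q < d → ∀ j → initial q j < d
initial-< {d} q<d j with j ℤ.≟ ℤ.0ℤ
... | yes _ = q<d
... | no  _ = ≤-trans (s≤s z≤n) q<d

initial-≢0 : ∀ q {i} → i ≢ ℤ.0ℤ → initial q i ≡ 0
initial-≢0 q {i} i≢0 with i ℤ.≟ ℤ.0ℤ
... | yes i≡0 = ⊥-elim (i≢0 i≡0)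
... | no  _   = refl

mainTheorem8 : (a b a' b' d n p q : ℕ) →
    1 ≤ a → 1 ≤ b → d ≡ gcd a b → 1 < d →
    a ≡ a' * d → b ≡ b' * d →
    n ≡ p * d + q → q < d →
    (σ : List ℤ) →
      ((Legal a b (initial n) σ → Legal a' b' (initial p) σ)
        × (Legal a' b' (initial p) σ → Legal a b (initial n) σ))
      × (Legal a' b' (initial p) σ →
          (run a b (initial n) σ ℤ.0ℤ ≡ d * run a' b' (initial p) σ ℤ.0ℤ + q)
          × ((i : ℤ) → i ≢ ℤ.0ℤ → run a b (initial n) σ i ≡ d * run a' b' (initial p) σ i))
mainTheorem8 a b a' b' d n p q _ _ _ _ refl refl refl q<d σ =
  (legal-unscaled a' b' σ (initial-< q<d) S , legal-scaled a' b' σ S) ,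
  λ L → let S′ = run-scaled a' b' σ S L in
    S′ ℤ.0ℤ , λ i i≢0 → trans (S′ i) (trans (cong (_ +_) (initial-≢0 q i≢0)) (+-identityʳ _))
  where
  S : Scaled d (initial q) (initial (p * d + q)) (initial p)
  S = initial-scaled d p q
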